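{- Let $S$ be a Seidel matrix of order $n$ such that $M:=SS^\top-aI$ is positive semidefinite for some integer $a$. Then each off-diagonal entry of $M$ is congruent to $n$ modulo $2$ and has absolute value at most $n-1-a$.
   Context: A Seidel matrix is a square $\{0,\pm1\}$-matrix $S$ with zero diagonal, all off-diagonal entries nonzero, and $S=\pm S^\top$. -}

module Defs where

open import Data.Nat as ℕ using (ℕ; zero; suc)
open import Data.Fin using (Fin; zero; suc)
open import Data.Integer as ℤ using (ℤ; +_; -_)
open import Data.Rational as ℚ using (ℚ; _/_)
open import Data.Product using (_×_)
open import Data.Sum using (_⊎_)
open import Relation.Binary.PropositionalEquality using (_≡_; _≢_)
open import Relation.Nullary using (yes; no)
open import Data.Fin using (_≟_)

Matrix : ℕ → Set
Matrix n = Fin n → Fin n → ℤ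

∑ℤ : ∀ {n} → (Fin n → ℤ) → ℤ
∑ℤ {zero}  f = + 0
∑ℤ {suc n} f = f zero ℤ.+ ∑ℤ (λ i → f (suc i))

∑ℚ : ∀ {n} → (Fin n → ℚ) → ℚ
∑ℚ {zero}  f = ℚ.0ℚ
∑ℚ {suc n} f = f zero ℚ.+ ∑ℚ (λ i → f (suc i))

IsSeidel : ∀ {n} → Matrix n → Set
IsSeidel {n} S =
  (∀ i → S i i ≡ + 0) ×
  (∀ i j → i ≢ j → (S i j ≡ + 1) ⊎ (S i j ≡ - + 1)) ×
  ((∀ i j → S i j ≡ S j i) ⊎ (∀ i j → S i j ≡ - S j i))

I : ∀ {n} → Matrix n
I i j with i ≟ j
... | yes _ = + 1
... | no  _ = + 0

SSᵀ-aI : ∀ {n} → Matrix n → ℤ → Matrix n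
SSᵀ-aI S a i j = ∑ℤ (λ k → S i k ℤ.* S j k) ℤ.- a ℤ.* I i j

IsPSD : ∀ {n} → Matrix n → Set
IsPSD {n} M = ∀ (x : Fin n → ℚ) →
  ℚ.0ℚ ℚ.≤ ∑ℚ (λ i → ∑ℚ (λ j → x i ℚ.* ((M i j / 1) ℚ.* x j)))

module Submission where

-- Let S be a Seidel matrix of order n, G = S Sᵀ its Gram matrix and
-- M = G - a I.  Both claims about an off-diagonal entry M i j = G i j
-- come from elementary facts:
--
--  * Parity.  G i j = ∑ₖ S i k · S j k.  The terms k = i and k = j vanish
--    and every other term is ±1, hence odd; so G i j ≡ n - 2 ≡ n (mod 2).
--    Formally, S i k · S j k + δ i k + δ j k is odd for every k, and
--    congruences mod 2 may be summed over k.
--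
--  * Bound.  Every row of S has n - 1 entries ±1, so M i i = n - 1 - a
--    for all i, and M is symmetric.  Testing positive semidefiniteness
--    on the integer vectors eᵢ ± eⱼ gives 2 (n - 1 - a) ± 2 M i j ≥ 0,
--    i.e. ∣ M i j ∣ ≤ n - 1 - a.

open import Defs
open import Data.Nat using (ℕ)
open import Data.Fin using (Fin)
open import Data.Integer using (ℤ; +_; _-_; _≤_; ∣_∣)
open import Data.Integer.Divisibility using (_∣_)
open import Data.Product using (_×_)
open import Relation.Binary.PropositionalEquality using (_≢_)

open import Data.Nat using (zero; suc)
open import Data.Fin using (zero; suc; _≟_)
open import Data.Integer using (-_; _+_; _*_; -[1+_])
import Data.Integer.Properties as ℤP
import Data.Integer.Divisibility.Signed as Signed
open import Data.Integer.Tactic.RingSolver using (solve-∀)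
open import Data.Rational as ℚ using (ℚ; _/_)
import Data.Rational.Properties as ℚP
import Data.Rational.Unnormalised as ℚᵘ
import Data.Rational.Unnormalised.Properties as ℚᵘP
open import Data.Product using (_,_; proj₁; proj₂)
open import Data.Sum using (_⊎_; inj₁; inj₂)
open import Relation.Binary.PropositionalEquality
  using (_≡_; refl; sym; trans; cong; cong₂; subst; module ≡-Reasoning)
open import Relation.Nullary using (yes; no)
open import Data.Empty using (⊥-elim)

∑-cong : ∀ {n} {f g : Fin n → ℤ} → (∀ k → f k ≡ g k) → ∑ℤ f ≡ ∑ℤ g
∑-cong {zero}  f≗g = refl
∑-cong {suc n} f≗g = cong₂ _+_ (f≗g zero) (∑-cong (λ k → f≗g (suc k)))

∑-+ : ∀ {n} (f g : Fin n → ℤ) → ∑ℤ (λ k → f k + g k) ≡ ∑ℤ f + ∑ℤ g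
∑-+ {zero}  f g = refl
∑-+ {suc n} f g =
  trans (cong (_+_ (f zero + g zero)) (∑-+ (λ k → f (suc k)) (λ k → g (suc k))))
        (interchange (f zero) (g zero) _ _)
  where
  interchange : ∀ a b c d → a + b + (c + d) ≡ a + c + (b + d)
  interchange = solve-∀

∑-zero : ∀ n → ∑ℤ {n} (λ _ → + 0) ≡ + 0
∑-zero zero    = refl
∑-zero (suc n) = trans (ℤP.+-identityˡ _) (∑-zero n)

∑-one : ∀ n → ∑ℤ {n} (λ _ → + 1) ≡ + n
∑-one zero    = refl
∑-one (suc n) = cong (_+_ (+ 1)) (∑-one n)

-- Congruences modulo d can be summed: if f k ≡ g k (mod d) for every k,
-- then ∑ f ≡ ∑ g (mod d).  (Signed divisibility, which has the additive
-- closure lemmas.)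
∑-congruence : ∀ {n} (d : ℤ) (f g : Fin n → ℤ) →
  (∀ k → d Signed.∣ f k - g k) → d Signed.∣ ∑ℤ f - ∑ℤ g
∑-congruence {zero}  d f g _ = Signed.divides (+ 0) (sym (ℤP.*-zeroˡ d))
∑-congruence {suc n} d f g d∣f-g =
  subst (d Signed.∣_) (sym (regroup (f zero) (g zero) _ _))
    (Signed.∣m∣n⇒∣m+n (d∣f-g zero)
      (∑-congruence d (λ k → f (suc k)) (λ k → g (suc k)) (λ k → d∣f-g (suc k))))
  where
  regroup : ∀ a b c e → a + c - (b + e) ≡ (a - b) + (c - e)
  regroup = solve-∀

-- The Kronecker delta, defined by recursion so that sums against it
-- compute; it agrees with the identity matrix I of Defs.

δ : ∀ {n} → Fin n → Fin n → ℤ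
δ zero    zero    = + 1
δ zero    (suc _) = + 0
δ (suc _) zero    = + 0
δ (suc i) (suc j) = δ i j

δ-diag : ∀ {n} (i : Fin n) → δ i i ≡ + 1
δ-diag zero    = refl
δ-diag (suc i) = δ-diag i

δ-off : ∀ {n} {i j : Fin n} → i ≢ j → δ i j ≡ + 0
δ-off {i = zero}  {zero}  i≢j = ⊥-elim (i≢j refl)
δ-off {i = zero}  {suc j} i≢j = refl
δ-off {i = suc i} {zero}  i≢j = refl
δ-off {i = suc i} {suc j} i≢j = δ-off (λ i≡j → i≢j (cong suc i≡j))

I≡δ : ∀ {n} (i j : Fin n) → I i j ≡ δ i j
I≡δ i j with i ≟ j
... | yes refl = sym (δ-diag i)
... | no  i≢j  = sym (δ-off i≢j)

∑-δ : ∀ {n} (i : Fin n) (g : Fin n → ℤ) → ∑ℤ (λ k → δ i k * g k) ≡ g i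
∑-δ {suc n} zero g = begin
  + 1 * g zero + ∑ℤ (λ k → + 0 * g (suc k))
    ≡⟨ cong (_+_ (+ 1 * g zero)) (∑-cong (λ k → ℤP.*-zeroˡ (g (suc k)))) ⟩
  + 1 * g zero + ∑ℤ {n} (λ _ → + 0)         ≡⟨ cong (_+_ (+ 1 * g zero)) (∑-zero n) ⟩
  + 1 * g zero + + 0                        ≡⟨ ℤP.+-identityʳ _ ⟩
  + 1 * g zero                              ≡⟨ ℤP.*-identityˡ _ ⟩
  g zero                                    ∎
  where open ≡-Reasoning
∑-δ {suc n} (suc i) g = trans (ℤP.+-identityˡ _) (∑-δ i (λ k → g (suc k)))

∑-δ-one : ∀ {n} (i : Fin n) → ∑ℤ (δ i) ≡ + 1
∑-δ-one i = trans (∑-cong (λ k → sym (ℤP.*-identityʳ (δ i k)))) (∑-δ i (λ _ → + 1))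

-- The rational quadratic form of Defs is tested on
-- integer vectors, so we need that z ↦ z / 1 is a ring homomorphism that
-- reflects nonnegativity.

ι : ℤ → ℚ
ι z = z / 1

ι-unnormalised : ∀ z → ℚ.toℚᵘ (ι z) ℚᵘ.≃ ℚᵘ.mkℚᵘ z 0
ι-unnormalised z = ℚP.toℚᵘ-fromℚᵘ (ℚᵘ.mkℚᵘ z 0)

ι-+ : ∀ a b → ι (a + b) ≡ ι a ℚ.+ ι b
ι-+ a b = ℚP.toℚᵘ-injective (begin
  ℚ.toℚᵘ (ι (a + b))                 ≈⟨ ι-unnormalised (a + b) ⟩
  ℚᵘ.mkℚᵘ (a + b) 0                  ≈⟨ ℚᵘ.*≡* (unit-denominators a b) ⟩
  ℚᵘ.mkℚᵘ a 0 ℚᵘ.+ ℚᵘ.mkℚᵘ b 0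
    ≈⟨ ℚᵘP.+-cong (ℚᵘP.≃-sym (ι-unnormalised a)) (ℚᵘP.≃-sym (ι-unnormalised b)) ⟩
  ℚ.toℚᵘ (ι a) ℚᵘ.+ ℚ.toℚᵘ (ι b)
    ≈⟨ ℚᵘP.≃-sym (ℚP.toℚᵘ-homo-+ (ι a) (ι b)) ⟩
  ℚ.toℚᵘ (ι a ℚ.+ ι b)               ∎)
  where
  open ℚᵘP.≃-Reasoning
  unit-denominators : ∀ a b → (a + b) * + 1 ≡ (a * + 1 + b * + 1) * + 1
  unit-denominators = solve-∀

ι-* : ∀ a b → ι (a * b) ≡ ι a ℚ.* ι b
ι-* a b = ℚP.toℚᵘ-injective (begin
  ℚ.toℚᵘ (ι (a * b))                 ≈⟨ ι-unnormalised (a * b) ⟩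
  ℚᵘ.mkℚᵘ (a * b) 0
    ≈⟨ ℚᵘP.*-cong (ℚᵘP.≃-sym (ι-unnormalised a)) (ℚᵘP.≃-sym (ι-unnormalised b)) ⟩
  ℚ.toℚᵘ (ι a) ℚᵘ.* ℚ.toℚᵘ (ι b)
    ≈⟨ ℚᵘP.≃-sym (ℚP.toℚᵘ-homo-* (ι a) (ι b)) ⟩
  ℚ.toℚᵘ (ι a ℚ.* ι b)               ∎)
  where open ℚᵘP.≃-Reasoning

ι-reflects-nonneg : ∀ z → ℚ.0ℚ ℚ.≤ ι z → + 0 ≤ z
ι-reflects-nonneg z 0≤ιz with ℚᵘP.≤-respʳ-≃ (ι-unnormalised z) (ℚP.toℚᵘ-mono-≤ 0≤ιz)
... | ℚᵘ.*≤* 0*1≤z*1 = subst (+ 0 ≤_) (ℤP.*-identityʳ z) 0*1≤z*1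

∑ℚ-ι : ∀ {n} (g : Fin n → ℚ) (f : Fin n → ℤ) →
  (∀ k → g k ≡ ι (f k)) → ∑ℚ g ≡ ι (∑ℤ f)
∑ℚ-ι {zero}  g f g≗ιf = refl
∑ℚ-ι {suc n} g f g≗ιf =
  trans (cong₂ ℚ._+_ (g≗ιf zero)
                     (∑ℚ-ι (λ k → g (suc k)) (λ k → f (suc k)) (λ k → g≗ιf (suc k))))
        (sym (ι-+ (f zero) _))

quadForm : ∀ {n} → Matrix n → (Fin n → ℤ) → ℤ
quadForm M y = ∑ℤ (λ a → ∑ℤ (λ b → y a * (M a b * y b)))

psd⇒quadForm-nonneg : ∀ {n} (M : Matrix n) → IsPSD M → ∀ y → + 0 ≤ quadForm M y
psd⇒quadForm-nonneg M psd y =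
  ι-reflects-nonneg _ (subst (ℚ.0ℚ ℚ.≤_) rational≡integral (psd (λ k → ι (y k))))
  where
  entry : ∀ a b → ι (y a) ℚ.* (ι (M a b) ℚ.* ι (y b)) ≡ ι (y a * (M a b * y b))
  entry a b = trans (cong (ι (y a) ℚ.*_) (sym (ι-* (M a b) (y b))))
                    (sym (ι-* (y a) (M a b * y b)))
  rational≡integral : ∑ℚ (λ a → ∑ℚ (λ b → ι (y a) ℚ.* (ι (M a b) ℚ.* ι (y b))))
                    ≡ ι (quadForm M y)
  rational≡integral = ∑ℚ-ι _ _ (λ a → ∑ℚ-ι _ _ (entry a))

pairVector : ∀ {n} → Fin n → Fin n → ℤ → Fin n → ℤ
pairVector i j s k = δ i k + s * δ j k

quadForm-pairVector : ∀ {n} (M : Matrix n) (i j : Fin n) (s : ℤ) →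
  quadForm M (pairVector i j s) ≡ M i i + s * M i j + s * (M j i + s * M j j)
quadForm-pairVector M i j s = trans (∑-cong inner) outer
  where
  y = pairVector i j s
  split-inner : ∀ ya m di dj s → ya * (m * (di + s * dj)) ≡ di * (ya * m) + dj * (s * ya * m)
  split-inner = solve-∀
  split-outer : ∀ di dj s mi mj → (di + s * dj) * mi + s * (di + s * dj) * mj
                                ≡ di * (mi + s * mj) + dj * (s * (mi + s * mj))
  split-outer = solve-∀
  inner : ∀ a → ∑ℤ (λ b → y a * (M a b * y b)) ≡ y a * M a i + s * y a * M a j
  inner a = begin
    ∑ℤ (λ b → y a * (M a b * y b))
      ≡⟨ ∑-cong (λ b → split-inner (y a) (M a b) (δ i b) (δ j b) s) ⟩
    ∑ℤ (λ b → δ i b * (y a * M a b) + δ j b * (s * y a * M a b))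
      ≡⟨ ∑-+ (λ b → δ i b * (y a * M a b)) (λ b → δ j b * (s * y a * M a b)) ⟩
    ∑ℤ (λ b → δ i b * (y a * M a b)) + ∑ℤ (λ b → δ j b * (s * y a * M a b))
      ≡⟨ cong₂ _+_ (∑-δ i (λ b → y a * M a b)) (∑-δ j (λ b → s * y a * M a b)) ⟩
    y a * M a i + s * y a * M a j ∎
    where open ≡-Reasoning
  outer : ∑ℤ (λ a → y a * M a i + s * y a * M a j)
          ≡ M i i + s * M i j + s * (M j i + s * M j j)
  outer = begin
    ∑ℤ (λ a → y a * M a i + s * y a * M a j)
      ≡⟨ ∑-cong (λ a → split-outer (δ i a) (δ j a) s (M a i) (M a j)) ⟩
    ∑ℤ (λ a → δ i a * (M a i + s * M a j) + δ j a * (s * (M a i + s * M a j)))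
      ≡⟨ ∑-+ (λ a → δ i a * (M a i + s * M a j)) (λ a → δ j a * (s * (M a i + s * M a j))) ⟩
    ∑ℤ (λ a → δ i a * (M a i + s * M a j)) + ∑ℤ (λ a → δ j a * (s * (M a i + s * M a j)))
      ≡⟨ cong₂ _+_ (∑-δ i (λ a → M a i + s * M a j)) (∑-δ j (λ a → s * (M a i + s * M a j))) ⟩
    M i i + s * M i j + s * (M j i + s * M j j) ∎
    where open ≡-Reasoning

abs≤ : ∀ m c → + 0 ≤ c + m → + 0 ≤ c - m → + ∣ m ∣ ≤ c
abs≤ (+ k)    c _       0≤c-m = ℤP.0≤i-j⇒j≤i 0≤c-m
abs≤ -[1+ k ] c 0≤c+m _       = ℤP.0≤i-j⇒j≤i 0≤c+m

-- In a positive semidefinite matrix whose (i, j) block is [[c, m], [m, c]],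
-- the off-diagonal entry is bounded by the diagonal one: test the form
-- on eᵢ ± eⱼ, which gives 2 (c ± m) ≥ 0.
psd⇒off-diagonal-bound : ∀ {n} (M : Matrix n) → IsPSD M → ∀ i j (c m : ℤ) →
  M i i ≡ c → M j j ≡ c → M i j ≡ m → M j i ≡ m → + ∣ m ∣ ≤ c
psd⇒off-diagonal-bound M psd i j c m Mii Mjj Mij Mji =
  abs≤ m c (nonneg-half (c + m) (form-at (+ 1) (plus c m)))
           (nonneg-half (c - m) (form-at (- + 1) (minus c m)))
  where
  form-at : ∀ s {r} → c + s * m + s * (m + s * c) ≡ r → + 0 ≤ r
  form-at s block≡r = subst (+ 0 ≤_)
    (trans (quadForm-pairVector M i j s)
      (trans (cong₂ (λ u v → u + s * M i j + s * (M j i + s * v)) Mii Mjj)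
        (trans (cong₂ (λ u v → c + s * u + s * (v + s * c)) Mij Mji) block≡r)))
    (psd⇒quadForm-nonneg M psd (pairVector i j s))
  plus : ∀ c m → c + + 1 * m + + 1 * (m + + 1 * c) ≡ (c + m) * + 2
  plus = solve-∀
  minus : ∀ c m → c + - + 1 * m + - + 1 * (m + - + 1 * c) ≡ (c - m) * + 2
  minus = solve-∀
  nonneg-half : ∀ x → + 0 ≤ x * + 2 → + 0 ≤ x
  nonneg-half x = ℤP.*-cancelʳ-≤-pos (+ 0) x (+ 2)

module Seidel {n : ℕ} (S : Matrix n) (seidel : IsSeidel S) where

  zero-diagonal : ∀ i → S i i ≡ + 0
  zero-diagonal = proj₁ seidel

  unit-off-diagonal : ∀ i j → i ≢ j → (S i j ≡ + 1) ⊎ (S i j ≡ - + 1)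
  unit-off-diagonal = proj₁ (proj₂ seidel)

  gram : Matrix n
  gram i j = ∑ℤ (λ k → S i k * S j k)

  entry-square : ∀ i k → S i k * S i k + δ i k ≡ + 1
  entry-square i k with i ≟ k
  ... | yes refl rewrite zero-diagonal i | δ-diag i = refl
  ... | no  i≢k  rewrite δ-off i≢k with unit-off-diagonal i k i≢k
  ...   | inj₁ Sik≡1  rewrite Sik≡1 = refl
  ...   | inj₂ Sik≡-1 rewrite Sik≡-1 = refl

  -- Each row of S has n - 1 nonzero entries, all ±1.
  gram-diagonal : ∀ i → gram i i + + 1 ≡ + n
  gram-diagonal i = begin
    gram i i + + 1
      ≡⟨ cong (_+_ (gram i i)) (sym (∑-δ-one i)) ⟩
    gram i i + ∑ℤ (δ i)
      ≡⟨ sym (∑-+ (λ k → S i k * S i k) (δ i)) ⟩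
    ∑ℤ (λ k → S i k * S i k + δ i k)
      ≡⟨ ∑-cong (entry-square i) ⟩
    ∑ℤ {n} (λ _ → + 1)
      ≡⟨ ∑-one n ⟩
    + n ∎
    where open ≡-Reasoning

  product-parity : ∀ i j → i ≢ j → ∀ k →
    + 2 Signed.∣ (S i k * S j k + δ i k + δ j k) - + 1
  product-parity i j i≢j k with k ≟ i
  ... | yes refl rewrite zero-diagonal k | δ-diag k | δ-off (λ j≡k → i≢j (sym j≡k))
                       | ℤP.*-zeroˡ (S j k) = Signed.divides (+ 0) refl
  ... | no  k≢i with k ≟ j
  ...   | yes refl rewrite zero-diagonal k | δ-diag k | δ-off i≢j
                         | ℤP.*-zeroʳ (S i k) = Signed.divides (+ 0) refl
  ...   | no  k≢j rewrite δ-off (λ i≡k → k≢i (sym i≡k)) | δ-off (λ j≡k → k≢j (sym j≡k))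
                  with unit-off-diagonal i k (λ i≡k → k≢i (sym i≡k))
                     | unit-off-diagonal j k (λ j≡k → k≢j (sym j≡k))
  ...     | inj₁ Sik | inj₁ Sjk rewrite Sik | Sjk = Signed.divides (+ 0) refl
  ...     | inj₁ Sik | inj₂ Sjk rewrite Sik | Sjk = Signed.divides (- + 1) refl
  ...     | inj₂ Sik | inj₁ Sjk rewrite Sik | Sjk = Signed.divides (- + 1) refl
  ...     | inj₂ Sik | inj₂ Sjk rewrite Sik | Sjk = Signed.divides (+ 0) refl

  gram-parity : ∀ i j → i ≢ j → + 2 Signed.∣ gram i j - + n
  gram-parity i j i≢j =
    subst (+ 2 Signed.∣_) (regroup (gram i j) (+ n))
      (Signed.∣m∣n⇒∣m-n (subst (+ 2 Signed.∣_) sum≡ summed) Signed.∣-refl)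
    where
    summed : + 2 Signed.∣ ∑ℤ (λ k → S i k * S j k + δ i k + δ j k) - ∑ℤ {n} (λ _ → + 1)
    summed = ∑-congruence (+ 2) _ _ (product-parity i j i≢j)
    sum≡ : ∑ℤ (λ k → S i k * S j k + δ i k + δ j k) - ∑ℤ {n} (λ _ → + 1)
         ≡ gram i j + + 1 + + 1 - + n
    sum≡ = begin
      ∑ℤ (λ k → S i k * S j k + δ i k + δ j k) - ∑ℤ {n} (λ _ → + 1)
        ≡⟨ cong₂ _-_ (∑-+ (λ k → S i k * S j k + δ i k) (δ j)) (∑-one n) ⟩
      ∑ℤ (λ k → S i k * S j k + δ i k) + ∑ℤ (δ j) - + n
        ≡⟨ cong (λ t → t + ∑ℤ (δ j) - + n) (∑-+ (λ k → S i k * S j k) (δ i)) ⟩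
      gram i j + ∑ℤ (δ i) + ∑ℤ (δ j) - + n
        ≡⟨ cong₂ (λ u v → gram i j + u + v - + n) (∑-δ-one i) (∑-δ-one j) ⟩
      gram i j + + 1 + + 1 - + n ∎
      where open ≡-Reasoning
    regroup : ∀ g n → g + + 1 + + 1 - n - + 2 ≡ g - n
    regroup = solve-∀

  gram-symmetric : ∀ i j → gram i j ≡ gram j i
  gram-symmetric i j = ∑-cong (λ k → ℤP.*-comm (S i k) (S j k))

  M-diagonal : ∀ a i → SSᵀ-aI S a i i ≡ + n - + 1 - a
  M-diagonal a i = begin
    gram i i - a * I i i          ≡⟨ cong (λ u → gram i i - a * u) (trans (I≡δ i i) (δ-diag i)) ⟩
    gram i i - a * + 1            ≡⟨ shift (gram i i) a ⟩
    gram i i + + 1 - + 1 - a      ≡⟨ cong (λ u → u - + 1 - a) (gram-diagonal i) ⟩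
    + n - + 1 - a                 ∎
    where
    open ≡-Reasoning
    shift : ∀ g a → g - a * + 1 ≡ g + + 1 - + 1 - a
    shift = solve-∀

  M-off-diagonal : ∀ a i j → i ≢ j → SSᵀ-aI S a i j ≡ gram i j
  M-off-diagonal a i j i≢j = begin
    gram i j - a * I i j   ≡⟨ cong (λ u → gram i j - a * u) (trans (I≡δ i j) (δ-off i≢j)) ⟩
    gram i j - a * + 0     ≡⟨ cong (_-_ (gram i j)) (ℤP.*-zeroʳ a) ⟩
    gram i j - + 0         ≡⟨ ℤP.+-identityʳ (gram i j) ⟩
    gram i j               ∎
    where open ≡-Reasoning

lemma3p6 : (n : ℕ) (S : Matrix n) (a : ℤ) →
    IsSeidel S → IsPSD (SSᵀ-aI S a) →
    ∀ (i j : Fin n) → i ≢ j →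
      (+ 2 ∣ (SSᵀ-aI S a i j - + n)) ×
      (+ ∣ SSᵀ-aI S a i j ∣ ≤ + n - + 1 - a)
lemma3p6 n S a seidel psd i j i≢j = parity , bound
  where
  open Seidel S seidel
  M = SSᵀ-aI S a
  parity : + 2 ∣ (M i j - + n)
  parity = Signed.∣⇒∣ᵤ (subst (λ t → + 2 Signed.∣ t - + n)
                               (sym (M-off-diagonal a i j i≢j)) (gram-parity i j i≢j))
  bound : + ∣ M i j ∣ ≤ + n - + 1 - a
  bound = psd⇒off-diagonal-bound M psd i j (+ n - + 1 - a) (M i j)
    (M-diagonal a i) (M-diagonal a j) refl
    (trans (M-off-diagonal a j i (λ j≡i → i≢j (sym j≡i)))
      (trans (gram-symmetric j i) (sym (M-off-diagonal a i j i≢j))))
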